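{- For any integer $k\geq 1$, every graph $G$ of cliquewidth at most $k$ admits a dominated partition $\mathcal{P}$ such that the quotient $G/\mathcal{P}$ has treewidth at most $k-1$.
   Context: Graphs are finite and simple. $N_G[v]$ is the closed neighbourhood of $v$ (the vertex $v$ together with its neighbours). A set $S\subseteq V(G)$ is dominated in $G$ if $S\subseteq N_G[v]$ for some $v\in V(G)$. A partition $\mathcal{P}$ of $G$ is a collection of nonempty pairwise disjoint subsets (parts) of $V(G)$ with union $V(G)$ (parts need not induce connected subgraphs); it is dominated if every part is dominated in $G$. The quotient $G/\mathcal{P}$ has vertex set $\mathcal{P}$, with two distinct parts adjacent iff some vertex of one is adjacent in $G$ to some vertex of the other. Cliquewidth: with colourings $c:V(G)\to\{1,\dots,k\}$ (colour $i$ used if $c^{ -1}(i)\ne\emptyset$), $(G,c)$ is a cliquewidth-$k$ pair if $|V(G)|\leq 1$ or: (OP1) $G$ is the disjoint union of nonempty $G_1,G_2$ with $(G_1,c|_{V(G_1)}),(G_2,c|_{V(G_2)})$ cliquewidth-$k$ pairs; or (OP2) there are a colouring $c'$ and distinct $i,j$, both used by $c'$, with $(G,c')$ a cliquewidth-$k$ pair and $c$ obtained from $c'$ by recolouring every vertex of colour $i$ to $j$; or (OP3) there are a proper spanning subgraph $G'$ of $G$ and distinct $i,j$ with $(G',c)$ a cliquewidth-$k$ pair and $G$ obtained from $G'$ by adding all edges between vertices coloured $i$ and vertices coloured $j$. The cliquewidth of $G$ is the least $k$ such that $(G,c)$ is a cliquewidth-$k$ pair for some colouring $c$ with colours $\{1,\dots,k\}$.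 Treewidth is the usual minimum width (maximum bag size minus 1) of a tree-decomposition. -}

module Defs where

open import Data.Nat using (ℕ; zero; suc; _≤_; _∸_)
open import Data.Fin using (Fin; zero; suc; inject₁; fromℕ; _≟_)
open import Data.Fin.Subset using (Subset; _∈_; ∣_∣)
open import Data.Bool using (Bool; true; false; _∨_; if_then_else_)
open import Data.Product using (Σ; ∃; _×_; _,_)
open import Data.Sum using (_⊎_)
open import Data.Unit using (⊤)
open import Data.Empty using (⊥)
open import Relation.Nullary using (¬_)
open import Relation.Nullary.Decidable using (⌊_⌋)
open import Relation.Binary.PropositionalEquality using (_≡_; _≢_)
open import Function.Definitions using (Injective)

-- Finite simple graphs on vertex set Fin n (any finite graph up to iso)

record Graph (n : ℕ) : Set where
  field
    adj    : Fin n → Fin n → Bool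
    sym    : ∀ u v → adj u v ≡ adj v u
    irrefl : ∀ v → adj v v ≡ false
open Graph public

-- We work inside an ambient vertex type Fin N: a "graph" in the inductive
-- definition is a vertex set S ⊆ Fin N (as a Bool predicate) together with an
-- edge relation E (only its values on S matter), and c a colouring with
-- colours Fin k (= {1,…,k}); only the values of c on S matter.

VSet : ℕ → Set
VSet N = Fin N → Bool

Rel : ℕ → Set
Rel N = Fin N → Fin N → Bool

_∈V_ : ∀ {N} → Fin N → VSet N → Set
v ∈V S = S v ≡ true

Used : ∀ {N k} → VSet N → (Fin N → Fin k) → Fin k → Set
Used S c i = Σ _ λ v → v ∈V S × c v ≡ i

recol : ∀ {k} → Fin k → Fin k → Fin k → Fin k
recol i j x = if ⌊ x ≟ i ⌋ then j else x

data CWPair (k : ℕ) {N : ℕ} : VSet N → Rel N → (Fin N → Fin k) → Set where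
  base : ∀ {S E c} →
         (∀ u v → u ∈V S → v ∈V S → u ≡ v) →
         CWPair k S E c
  op1  : ∀ {S E c} (S₁ S₂ : VSet N) →
         (∀ v → S v ≡ (S₁ v ∨ S₂ v)) →
         (∀ v → v ∈V S₁ → S₂ v ≡ false) →
         (Σ _ λ v → v ∈V S₁) →
         (Σ _ λ v → v ∈V S₂) →
         (∀ u v → u ∈V S₁ → v ∈V S₂ → E u v ≡ false) →
         CWPair k S₁ E c →
         CWPair k S₂ E c →
         CWPair k S E c
  op2  : ∀ {S E c} (c' : Fin N → Fin k) (i j : Fin k) →
         i ≢ j → Used S c' i → Used S c' j →
         CWPair k S E c' →
         (∀ v → v ∈V S → c v ≡ recol i j (c' v)) →
         CWPair k S E c
  -- (OP3) adding all edges between colours i and j to a proper spanning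
  -- (simple) subgraph E'
  op3  : ∀ {S E c} (E' : Rel N) (i j : Fin k) →
         i ≢ j →
         (∀ u v → u ∈V S → v ∈V S → E' u v ≡ E' v u) →
         (∀ v → v ∈V S → E' v v ≡ false) →
         (∀ u v → u ∈V S → v ∈V S → E' u v ≡ true → E u v ≡ true) →
         (Σ _ λ u → Σ _ λ v → u ∈V S × v ∈V S × E u v ≡ true × E' u v ≡ false) →
         (∀ u v → u ∈V S → v ∈V S → E u v ≡ true →
            E' u v ≡ true ⊎ (c u ≡ i × c v ≡ j) ⊎ (c u ≡ j × c v ≡ i)) →
         (∀ u v → u ∈V S → v ∈V S →
            (E' u v ≡ true ⊎ (c u ≡ i × c v ≡ j) ⊎ (c u ≡ j × c v ≡ i)) →
            E u v ≡ true) →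
         CWPair k S E' c →
         CWPair k S E c

CliquewidthAtMost : ∀ {n} → ℕ → Graph n → Set
CliquewidthAtMost {n} k G =
  Σ ℕ λ k' → k' ≤ k × Σ (Fin n → Fin k') λ c → CWPair k' (λ _ → true) (adj G) c

-- Partitions: a partition of Fin n into m nonempty parts is encoded by a
-- surjective map p : Fin n → Fin m (part of v is p v).

Surjective : ∀ {n m} → (Fin n → Fin m) → Set
Surjective {n} {m} p = ∀ (a : Fin m) → Σ (Fin n) λ v → p v ≡ a

Dominated : ∀ {n m} → Graph n → (Fin n → Fin m) → Set
Dominated {n} {m} G p =
  ∀ (a : Fin m) → Σ (Fin n) λ w → ∀ u → p u ≡ a → u ≡ w ⊎ adj G w u ≡ true

QuotAdj : ∀ {n m} → Graph n → (Fin n → Fin m) → Fin m → Fin m → Set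
QuotAdj {n} G p a b =
  a ≢ b × Σ (Fin n) λ u → Σ (Fin n) λ v → p u ≡ a × p v ≡ b × adj G u v ≡ true

data Walk {t : ℕ} (R : Fin t → Fin t → Set) (P : Fin t → Set) : Fin t → Fin t → Set where
  here : ∀ {x} → P x → Walk R P x x
  step : ∀ {x y z} → P x → R x y → Walk R P y z → Walk R P x z

Connected : ∀ {t} → (Fin t → Fin t → Set) → Set
Connected R = ∀ x y → Walk R (λ _ → ⊤) x y

-- a cycle of length ℓ+1 ≥ 3 on distinct vertices f 0, …, f ℓ
Cycle : ∀ {t} → (Fin t → Fin t → Set) → Set
Cycle {t} R =
  Σ ℕ λ ℓ → 2 ≤ ℓ × Σ (Fin (suc ℓ) → Fin t) λ f →
    Injective _≡_ _≡_ f ×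
    (∀ (i : Fin ℓ) → R (f (inject₁ i)) (f (suc i))) ×
    R (f (fromℕ ℓ)) (f zero)

record Tree (t : ℕ) : Set₁ where
  field
    tadj      : Fin t → Fin t → Set
    tsym      : ∀ x y → tadj x y → tadj y x
    tirrefl   : ∀ x → ¬ tadj x x
    nonempty  : 1 ≤ t
    connected : Connected tadj
    acyclic   : ¬ Cycle tadj
open Tree public

TreewidthAtMost : (m : ℕ) → (Fin m → Fin m → Set) → ℕ → Set₁
TreewidthAtMost m Q w =
  Σ ℕ λ t → Σ (Tree t) λ T → Σ (Fin t → Subset m) λ B →
    (∀ x → Σ (Fin t) λ s → x ∈ B s) ×
    (∀ x y → Q x y → Σ (Fin t) λ s → x ∈ B s × y ∈ B s) ×
    (∀ x s s' → x ∈ B s → x ∈ B s' → Walk (tadj T) (λ r → x ∈ B r) s s') ×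
    (∀ s → ∣ B s ∣ ≤ suc w)

{-# OPTIONS --safe #-}
module Submission where

-- Read a k-expression of G from the root downwards.  At a join of colours i and j, one vertex of
-- colour i and one of colour j become the representatives of these colours, unless a join higher
-- up has already chosen them.  Each vertex goes to the part of the representative of its colour
-- at the highest join involving that colour, or forms a part of its own.  The part of the
-- colour-i representative then consists of colour-i vertices, all adjacent to the colour-j
-- representative, so every part is dominated.  The bags follow the disjoint unions of the
-- expression: a union contributes the bag of representatives assigned at that point, at most
-- one per colour, so every bag has at most k elements.

open import Defs hiding (sym)
open import Data.Nat using (ℕ; zero; suc; _+_; _≤_; _<_; _∸_; z≤n; s≤s)
open import Data.Nat.Properties
  using (≤-refl; ≤-trans; ≤-total; ≤-reflexive; <-irrefl; <⇒≱; n≤1+n; +-suc; +-mono-≤; +-monoʳ-≤;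
         m≢1+n+m; m+[n∸m]≡n)
open import Data.Fin using (Fin; zero; suc; inject₁; fromℕ; toℕ; _↑ˡ_; _↑ʳ_; splitAt; _≟_)
open import Data.Fin.Properties
  using (toℕ-inject₁; splitAt-↑ˡ; splitAt-↑ʳ; splitAt⁻¹-↑ˡ; splitAt⁻¹-↑ʳ; suc-injective; any?)
open import Data.Fin.Subset using (Subset; _∈_; ∣_∣; ⁅_⁆; ⊥; _∪_)
open import Data.Fin.Subset.Properties using (∣⊥∣≡0; ∣⁅x⁆∣≡1; x∈⁅x⁆; x∈p∪q⁺; p⊆q⇒∣p∣≤∣q∣)
open import Data.Vec using ([]; _∷_; tabulate)
open import Data.Vec.Properties using (lookup∘tabulate; lookup⇒[]=; []=⇒lookup)
open import Data.Bool using (Bool; true; false; if_then_else_; _∨_)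
open import Data.Bool.Properties using (∨-zeroʳ)
import Data.Bool as Bool
open import Data.Maybe using (Maybe; just; nothing; maybe; fromMaybe; _<∣>_)
import Data.Maybe as Maybe
open import Data.Maybe.Properties using (just-injective; ≡-dec)
open import Data.Product using (Σ; ∃; ∃₂; _×_; _,_; proj₁; proj₂)
import Data.Product as Product
open import Data.Sum using (_⊎_; inj₁; inj₂; [_,_]′; swap; map₁; map₂)
import Data.Sum as Sum
open import Data.Unit using (⊤; tt)
open import Data.Empty using (⊥-elim)
open import Function using (_∘_; case_of_)
open import Function.Definitions using (Injective)
open import Relation.Nullary using (¬_; Dec; yes; no; does)
open import Relation.Nullary.Decidable using (dec-true; dec-false)
open import Relation.Unary using (Decidable)
open import Relation.Binary.PropositionalEquality using (_≡_; _≢_; refl; sym; trans; cong; cong-app; subst)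

module _ {t : ℕ} {R : Fin t → Fin t → Set} {P : Fin t → Set} where

  Walk-head : ∀ {x y} → Walk R P x y → P x
  Walk-head (here p)     = p
  Walk-head (step p _ _) = p

  infixr 5 _++ʷ_
  _++ʷ_ : ∀ {x y z} → Walk R P x y → Walk R P y z → Walk R P x z
  here _     ++ʷ w' = w'
  step p r w ++ʷ w' = step p r (w ++ʷ w')

  Walk-reverse : (∀ {x y} → R x y → R y x) → ∀ {x y} → Walk R P x y → Walk R P y x
  Walk-reverse R-sym (here p)     = here p
  Walk-reverse R-sym (step p r w) = Walk-reverse R-sym w ++ʷ step (Walk-head w) (R-sym r) (here p)

Walk-map : ∀ {t t'} {R : Fin t → Fin t → Set} {P : Fin t → Set}
           {R' : Fin t' → Fin t' → Set} {P' : Fin t' → Set} (φ : Fin t → Fin t') →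
           (∀ {x y} → R x y → R' (φ x) (φ y)) → (∀ {x} → P x → P' (φ x)) →
           ∀ {x y} → Walk R P x y → Walk R' P' (φ x) (φ y)
Walk-map φ φ-R φ-P (here p)     = here (φ-P p)
Walk-map φ φ-R φ-P (step p r w) = step (φ-P p) (φ-R r) (Walk-map φ φ-R φ-P w)

argmax : ∀ {n} (g : Fin (suc n) → ℕ) → ∃ λ m → ∀ i → g i ≤ g m
argmax {zero}  g = zero , λ { zero → ≤-refl }
argmax {suc n} g with argmax (g ∘ suc)
... | m , max with ≤-total (g zero) (g (suc m))
...   | inj₁ le = suc m , λ { zero → le ; (suc i) → max i }
...   | inj₂ ge = zero  , λ { zero → ≤-refl ; (suc i) → ≤-trans (max i) ge }

data LastOrInject₁ : ∀ {n} → Fin (suc n) → Set where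
  is-last    : ∀ {n} → LastOrInject₁ (fromℕ n)
  is-inject₁ : ∀ {n} (j : Fin n) → LastOrInject₁ (inject₁ j)

lastOrInject₁ : ∀ {n} (i : Fin (suc n)) → LastOrInject₁ i
lastOrInject₁ {zero}  zero    = is-last
lastOrInject₁ {suc n} zero    = is-inject₁ zero
lastOrInject₁ {suc n} (suc i) with lastOrInject₁ i
... | is-last      = is-last
... | is-inject₁ j = is-inject₁ (suc j)

module _ {t : ℕ} {R : Fin t → Fin t → Set} (R-sym : ∀ {x y} → R x y → R y x) where

  cycle-neighbours : ∀ {ℓ} → 2 ≤ ℓ → (f : Fin (suc ℓ) → Fin t) →
                     (∀ i → R (f (inject₁ i)) (f (suc i))) → R (f (fromℕ ℓ)) (f zero) →
                     ∀ m → ∃₂ λ a b → a ≢ b × R (f m) (f a) × R (f m) (f b)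
  cycle-neighbours (s≤s (s≤s _)) f edge close zero =
    suc zero , fromℕ _ , (λ ()) , edge zero , R-sym close
  cycle-neighbours (s≤s (s≤s _)) f edge close (suc m) with lastOrInject₁ m
  ... | is-last      = inject₁ (fromℕ _) , zero , (λ ()) , R-sym (edge (fromℕ _)) , close
  ... | is-inject₁ j = inject₁ (inject₁ j) , suc (suc j) , two-apart , R-sym (edge (inject₁ j)) , edge (suc j)
    where
      two-apart : inject₁ (inject₁ j) ≢ suc (suc j)
      two-apart eq = m≢1+n+m (toℕ j) (trans (sym (trans (toℕ-inject₁ (inject₁ j)) (toℕ-inject₁ j))) (cong toℕ eq))

ParentAdj : ∀ {t} → (Fin t → Maybe (Fin t)) → Fin t → Fin t → Set
ParentAdj parent x y = parent x ≡ just y ⊎ parent y ≡ just x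

record RootedTree (t : ℕ) : Set where
  field
    parent       : Fin t → Maybe (Fin t)
    depth        : Fin t → ℕ
    root         : Fin t
    parent-root  : parent root ≡ nothing
    depth-parent : ∀ {x y} → parent x ≡ just y → depth y < depth x
    walk-to-root : ∀ x → Walk (ParentAdj parent) (λ _ → ⊤) x root

  Adj : Fin t → Fin t → Set
  Adj = ParentAdj parent

  Adj-sym : ∀ {x y} → Adj x y → Adj y x
  Adj-sym = swap

  Adj-irrefl : ∀ x → ¬ Adj x x
  Adj-irrefl x (inj₁ e) = <-irrefl refl (depth-parent e)
  Adj-irrefl x (inj₂ e) = <-irrefl refl (depth-parent e)

  Adj-shallower⇒parent : ∀ {x y} → Adj x y → depth y ≤ depth x → parent x ≡ just y
  Adj-shallower⇒parent (inj₁ e) _  = e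
  Adj-shallower⇒parent (inj₂ e) le = ⊥-elim (<⇒≱ (depth-parent e) le)

  -- A deepest vertex of a cycle would have both of its cycle neighbours as parent.
  acyclic′ : ¬ Cycle Adj
  acyclic′ (ℓ , 2≤ℓ , f , f-injective , edge , close) =
    let m , deepest = argmax (depth ∘ f)
        a , b , a≢b , m~a , m~b = cycle-neighbours {R = Adj} Adj-sym 2≤ℓ f edge close m
    in a≢b (f-injective (just-injective (trans (sym (Adj-shallower⇒parent m~a (deepest a)))
                                              (Adj-shallower⇒parent m~b (deepest b)))))

  toTree : Tree t
  toTree = record
    { tadj      = Adj
    ; tsym      = λ _ _ → Adj-sym
    ; tirrefl   = Adj-irrefl
    ; nonempty  = nonempty′ root
    ; connected = λ x y → walk-to-root x ++ʷ Walk-reverse {R = Adj} Adj-sym (walk-to-root y)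
    ; acyclic   = acyclic′
    }
    where
      nonempty′ : Fin t → 1 ≤ t
      nonempty′ zero    = s≤s z≤n
      nonempty′ (suc _) = s≤s z≤n

point : RootedTree 1
point = record
  { parent = λ _ → nothing ; depth = λ _ → 0 ; root = zero ; parent-root = refl
  ; depth-parent = λ () ; walk-to-root = λ { zero → here tt } }

data Position (t₁ t₂ : ℕ) : Fin (suc (t₁ + t₂)) → Set where
  at-root  : Position t₁ t₂ zero
  in-left  : ∀ x → Position t₁ t₂ (suc (x ↑ˡ t₂))
  in-right : ∀ y → Position t₁ t₂ (suc (t₁ ↑ʳ y))

position : ∀ t₁ t₂ z → Position t₁ t₂ z
position t₁ t₂ zero = at-root
position t₁ t₂ (suc z) with splitAt t₁ z in eq
... | inj₁ x = subst (Position t₁ t₂ ∘ suc) (splitAt⁻¹-↑ˡ eq) (in-left x)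
... | inj₂ y = subst (Position t₁ t₂ ∘ suc) (splitAt⁻¹-↑ʳ eq) (in-right y)

module Graft {t₁ t₂ : ℕ} (T₁ : RootedTree t₁) (T₂ : RootedTree t₂) where
  private
    module T₁ = RootedTree T₁
    module T₂ = RootedTree T₂

  t : ℕ
  t = suc (t₁ + t₂)

  left : Fin t₁ → Fin t
  left x = suc (x ↑ˡ t₂)

  right : Fin t₂ → Fin t
  right y = suc (t₁ ↑ʳ y)

  by-position : {A : Set} → A → (Fin t₁ → A) → (Fin t₂ → A) → Fin t → A
  by-position a f g zero    = a
  by-position a f g (suc z) = [ f , g ]′ (splitAt t₁ z)

  by-position-left : {A : Set} (a : A) → ∀ f g x → by-position a f g (left x) ≡ f x
  by-position-left a f g x = cong [ f , g ]′ (splitAt-↑ˡ t₁ x t₂)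

  by-position-right : {A : Set} (a : A) → ∀ f g y → by-position a f g (right y) ≡ g y
  by-position-right a f g y = cong [ f , g ]′ (splitAt-↑ʳ t₁ t₂ y)

  lift-parent : ∀ {s} → (Fin s → Fin t) → (Fin s → Maybe (Fin s)) → Fin s → Maybe (Fin t)
  lift-parent emb parent x = just (maybe emb zero (parent x))

  parent : Fin t → Maybe (Fin t)
  parent = by-position nothing (lift-parent left T₁.parent) (lift-parent right T₂.parent)

  depth : Fin t → ℕ
  depth = by-position 0 (suc ∘ T₁.depth) (suc ∘ T₂.depth)

  module Branch {s} (T : RootedTree s) (emb : Fin s → Fin t)
                (parent-emb : ∀ x → parent (emb x) ≡ lift-parent emb (RootedTree.parent T) x)
                (depth-emb : ∀ x → depth (emb x) ≡ suc (RootedTree.depth T x)) where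
    open RootedTree T using () renaming (parent to parentₛ; depth to depthₛ)

    lift-Adj : ∀ {x y} → ParentAdj parentₛ x y → ParentAdj parent (emb x) (emb y)
    lift-Adj {x} {y} (inj₁ e) = inj₁ (trans (parent-emb x) (cong (just ∘ maybe emb zero) e))
    lift-Adj {x} {y} (inj₂ e) = inj₂ (trans (parent-emb y) (cong (just ∘ maybe emb zero) e))

    parent-emb-root : parent (emb (RootedTree.root T)) ≡ just zero
    parent-emb-root = trans (parent-emb _) (cong (just ∘ maybe emb zero) (RootedTree.parent-root T))

    depth-lift-parent : ∀ x → depth (maybe emb zero (parentₛ x)) < suc (depthₛ x)
    depth-lift-parent x with parentₛ x in px
    ... | just y  = subst (_< suc (depthₛ x)) (sym (depth-emb y)) (s≤s (RootedTree.depth-parent T px))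
    ... | nothing = s≤s z≤n

    depth-parent : ∀ {x y} → parent (emb x) ≡ just y → depth y < depth (emb x)
    depth-parent {x} e
      rewrite just-injective (trans (sym e) (parent-emb x)) | depth-emb x = depth-lift-parent x

    walk-to-root : ∀ x → Walk (ParentAdj parent) (λ _ → ⊤) (emb x) zero
    walk-to-root x = Walk-map emb lift-Adj (λ _ → tt) (RootedTree.walk-to-root T x)
                     ++ʷ step tt (inj₁ parent-emb-root) (here tt)

  module Left  = Branch T₁ left  (by-position-left nothing _ (lift-parent right T₂.parent))
                                 (by-position-left 0 _ (suc ∘ T₂.depth))
  module Right = Branch T₂ right (by-position-right nothing (lift-parent left T₁.parent) _)
                                 (by-position-right 0 (suc ∘ T₁.depth) _)

  tree : RootedTree t
  tree = record
    { parent       = parent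
    ; depth        = depth
    ; root         = zero
    ; parent-root  = refl
    ; depth-parent = λ {x} → depth-parent′ (position t₁ t₂ x)
    ; walk-to-root = λ x → walk-to-root′ (position t₁ t₂ x)
    }
    where
      depth-parent′ : ∀ {x y} → Position t₁ t₂ x → parent x ≡ just y → depth y < depth x
      depth-parent′ at-root      ()
      depth-parent′ (in-left x)  = Left.depth-parent
      depth-parent′ (in-right y) = Right.depth-parent

      walk-to-root′ : ∀ {x} → Position t₁ t₂ x → Walk (ParentAdj parent) (λ _ → ⊤) x zero
      walk-to-root′ at-root      = here tt
      walk-to-root′ (in-left x)  = Left.walk-to-root x
      walk-to-root′ (in-right y) = Right.walk-to-root y

∣p∪q∣≤∣p∣+∣q∣ : ∀ {n} (p q : Subset n) → ∣ p ∪ q ∣ ≤ ∣ p ∣ + ∣ q ∣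
∣p∪q∣≤∣p∣+∣q∣ []          []          = z≤n
∣p∪q∣≤∣p∣+∣q∣ (true ∷ p)  (true ∷ q)  = s≤s (≤-trans (∣p∪q∣≤∣p∣+∣q∣ p q) (+-monoʳ-≤ ∣ p ∣ (n≤1+n ∣ q ∣)))
∣p∪q∣≤∣p∣+∣q∣ (true ∷ p)  (false ∷ q) = s≤s (∣p∪q∣≤∣p∣+∣q∣ p q)
∣p∪q∣≤∣p∣+∣q∣ (false ∷ p) (true ∷ q)  = ≤-trans (s≤s (∣p∪q∣≤∣p∣+∣q∣ p q)) (≤-reflexive (sym (+-suc ∣ p ∣ ∣ q ∣)))
∣p∪q∣≤∣p∣+∣q∣ (false ∷ p) (false ∷ q) = ∣p∪q∣≤∣p∣+∣q∣ p q

⁅_⁆ᵐ : ∀ {m} → Maybe (Fin m) → Subset m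
⁅ just a ⁆ᵐ  = ⁅ a ⁆
⁅ nothing ⁆ᵐ = ⊥

∣⁅x⁆ᵐ∣≤1 : ∀ {m} (x : Maybe (Fin m)) → ∣ ⁅ x ⁆ᵐ ∣ ≤ 1
∣⁅x⁆ᵐ∣≤1     (just a) = ≤-reflexive (∣⁅x⁆∣≡1 a)
∣⁅x⁆ᵐ∣≤1 {m} nothing  = ≤-trans (≤-reflexive (∣⊥∣≡0 m)) z≤n

image : ∀ {k m} → (Fin k → Maybe (Fin m)) → Subset m
image {zero}  g = ⊥
image {suc k} g = ⁅ g zero ⁆ᵐ ∪ image (g ∘ suc)

∣image∣≤k : ∀ {k m} (g : Fin k → Maybe (Fin m)) → ∣ image g ∣ ≤ k
∣image∣≤k {zero}  {m} g = ≤-reflexive (∣⊥∣≡0 m)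
∣image∣≤k {suc k}     g =
  ≤-trans (∣p∪q∣≤∣p∣+∣q∣ ⁅ g zero ⁆ᵐ _) (+-mono-≤ (∣⁅x⁆ᵐ∣≤1 (g zero)) (∣image∣≤k (g ∘ suc)))

∈image : ∀ {k m} (g : Fin k → Maybe (Fin m)) {col a} → g col ≡ just a → a ∈ image g
∈image g {zero}    {a} e = x∈p∪q⁺ (inj₁ (subst (λ x → a ∈ ⁅ x ⁆ᵐ) (sym e) (x∈⁅x⁆ a)))
∈image g {suc col}     e = x∈p∪q⁺ (inj₂ (∈image (g ∘ suc) e))

⊆image⇒∣p∣≤k : ∀ {k m} (p : Subset m) (g : Fin k → Maybe (Fin m)) →
                (∀ {a} → a ∈ p → ∃ λ col → g col ≡ just a) → ∣ p ∣ ≤ k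
⊆image⇒∣p∣≤k p g p⊆g = ≤-trans (p⊆q⇒∣p∣≤∣q∣ (∈image g ∘ proj₂ ∘ p⊆g)) (∣image∣≤k g)

record Enumeration {n} (P : Fin n → Set) : Set where
  field
    size      : ℕ
    element   : Fin size → Fin n
    injective : Injective _≡_ _≡_ element
    sound     : ∀ i → P (element i)
    complete  : ∀ {a} → P a → ∃ λ i → element i ≡ a

enumerate : ∀ {n} {P : Fin n → Set} → Decidable P → Enumeration P
enumerate {zero} P? = record
  { size = 0 ; element = λ () ; injective = λ { {()} } ; sound = λ () ; complete = λ { {()} } }
enumerate {suc n} {P} P? with enumerate (P? ∘ suc) | P? zero
... | E | yes p₀ = record
  { size      = suc E.size
  ; element   = element
  ; injective = injective
  ; sound     = λ { zero → p₀ ; (suc i) → E.sound i }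
  ; complete  = complete
  }
  where
    module E = Enumeration E
    element : Fin (suc E.size) → Fin (suc n)
    element zero    = zero
    element (suc i) = suc (E.element i)
    injective : Injective _≡_ _≡_ element
    injective {zero}  {zero}  _ = refl
    injective {suc i} {suc j} e = cong suc (E.injective (suc-injective e))
    complete : ∀ {a} → P a → ∃ λ i → element i ≡ a
    complete {zero}  _ = zero , refl
    complete {suc a} p = let i , e = E.complete p in suc i , cong suc e
... | E | no ¬p₀ = record
  { size      = E.size
  ; element   = suc ∘ E.element
  ; injective = E.injective ∘ suc-injective
  ; sound     = E.sound
  ; complete  = complete
  }
  where
    module E = Enumeration E
    complete : ∀ {a} → P a → ∃ λ i → suc (E.element i) ≡ a
    complete {zero}  p = ⊥-elim (¬p₀ p)
    complete {suc a} p = let i , e = E.complete p in i , cong suc e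

∈tabulate⁺ : ∀ {m} {f : Fin m → Bool} {i} → f i ≡ true → i ∈ tabulate f
∈tabulate⁺ {f = f} {i} e = lookup⇒[]= i (tabulate f) (trans (lookup∘tabulate f i) e)

∈tabulate⁻ : ∀ {m} {f : Fin m → Bool} {i} → i ∈ tabulate f → f i ≡ true
∈tabulate⁻ {f = f} {i} i∈ = trans (sym (lookup∘tabulate f i)) ([]=⇒lookup i∈)

from-does : ∀ {P : Set} (P? : Dec P) → does P? ≡ true → P
from-does (yes p) _ = p

-- Decompositions of a subexpression relative to the representatives L chosen by the joins above
-- it.  Parts of the quotient are named by a representative vertex (rep), and bags are sets of
-- representatives.
module Construction (k N : ℕ) where

  Assignment : Set
  Assignment = Fin k → Maybe (Fin N)

  Assigned : Assignment → Fin N → Set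
  Assigned L a = ∃ λ col → L col ≡ just a

  assigned? : ∀ L → Decidable (Assigned L)
  assigned? L a = any? (λ col → ≡-dec _≟_ (L col) (just a))

  Internal : Assignment → VSet N → Fin N → Set
  Internal L S a = a ∈V S × ¬ Assigned L a

  Coherent : Assignment → VSet N → (Fin N → Fin k) → Set
  Coherent L S c = ∀ v → v ∈V S → Assigned L v → L (c v) ≡ just v

  SymmetricOn : VSet N → Rel N → Set
  SymmetricOn S E = ∀ u v → u ∈V S → v ∈V S → E u v ≡ E v u

  DominatedPart : VSet N → Rel N → (Fin N → Fin N) → Fin N → Set
  DominatedPart S E rep a =
    (∃ λ w → w ∈V S × ∀ u → u ∈V S → rep u ≡ a → u ≡ w ⊎ E w u ≡ true) × rep a ≡ a

  record Decomposition (S : VSet N) (E : Rel N) (c : Fin N → Fin k) (L : Assignment) : Set where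
    field
      size                     : ℕ
      tree                     : RootedTree size
      bag                      : Fin size → VSet N
      rep                      : Fin N → Fin N
      rep-assigned             : ∀ u a → u ∈V S → L (c u) ≡ just a → rep u ≡ a
      rep-assigned-or-internal : ∀ u → u ∈V S → L (c u) ≡ just (rep u) ⊎ Internal L S (rep u)
      internal-dominated       : ∀ u → u ∈V S → Internal L S (rep u) → DominatedPart S E rep (rep u)
      rep-in-bag               : ∀ u → u ∈V S → ∃ λ s → rep u ∈V bag s
      edge-in-bag              : ∀ u v → u ∈V S → v ∈V S → E u v ≡ true →
                                 ∃ λ s → rep u ∈V bag s × rep v ∈V bag s
      bag-walk                 : ∀ a s s' → a ∈V bag s → a ∈V bag s' →
                                 Walk (RootedTree.Adj tree) (λ r → a ∈V bag r) s s'
      bag-coloured             : ∀ s → ∃ λ (g : Fin k → Maybe (Fin N)) →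
                                 ∀ a → a ∈V bag s → ∃ λ col → g col ≡ just a
      assigned-in-root         : ∀ a s → a ∈V bag s → Assigned L a → a ∈V bag (RootedTree.root tree)
      bag-assigned-or-internal : ∀ a s → a ∈V bag s → Assigned L a ⊎ Internal L S a

  empty : ∀ {S E c L} → (∀ v → ¬ v ∈V S) → Decomposition S E c L
  empty S-empty = record
    { size = 1 ; tree = point ; bag = λ _ _ → false ; rep = λ u → u
    ; rep-assigned             = λ u _ u∈S → ⊥-elim (S-empty u u∈S)
    ; rep-assigned-or-internal = λ u u∈S → ⊥-elim (S-empty u u∈S)
    ; internal-dominated       = λ u u∈S → ⊥-elim (S-empty u u∈S)
    ; rep-in-bag               = λ u u∈S → ⊥-elim (S-empty u u∈S)
    ; edge-in-bag              = λ u _ u∈S → ⊥-elim (S-empty u u∈S)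
    ; bag-walk                 = λ _ _ _ ()
    ; bag-coloured             = λ _ → (λ _ → nothing) , λ _ ()
    ; assigned-in-root         = λ _ _ ()
    ; bag-assigned-or-internal = λ _ _ ()
    }

  module Singleton {S : VSet N} {E : Rel N} {c : Fin N → Fin k} {L : Assignment}
                   (coherent : Coherent L S c) (v : Fin N) (v∈S : v ∈V S) (S⊆v : ∀ u → u ∈V S → u ≡ v) where

    rep : Fin N → Fin N
    rep u = fromMaybe u (L (c u))

    rep-cases : ∀ u → L (c u) ≡ just (rep u) ⊎ (L (c u) ≡ nothing × rep u ≡ u)
    rep-cases u with L (c u)
    ... | just _  = inj₁ refl
    ... | nothing = inj₂ (refl , refl)

    unassigned : ∀ u → u ∈V S → L (c u) ≡ nothing → ¬ Assigned L u
    unassigned u u∈S Lcu≡nothing asg with () ← trans (sym Lcu≡nothing) (coherent u u∈S asg)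

    rep-assigned-or-internal : ∀ u → u ∈V S → L (c u) ≡ just (rep u) ⊎ Internal L S (rep u)
    rep-assigned-or-internal u u∈S with rep-cases u
    ... | inj₁ e = inj₁ e
    ... | inj₂ (e , rep-u≡u) rewrite rep-u≡u = inj₂ (u∈S , unassigned u u∈S e)

    internal-dominated : ∀ u → u ∈V S → Internal L S (rep u) → DominatedPart S E rep (rep u)
    internal-dominated u u∈S (_ , ¬asg) with rep-cases u
    ... | inj₁ e = ⊥-elim (¬asg (c u , e))
    ... | inj₂ (_ , rep-u≡u) rewrite rep-u≡u =
      (u , u∈S , λ u' u'∈S _ → inj₁ (trans (S⊆v u' u'∈S) (sym (S⊆v u u∈S)))) , rep-u≡u

    bag : Fin 1 → VSet N
    bag _ a = does (a ≟ rep v)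

    rep∈bag : ∀ u → u ∈V S → rep u ∈V bag zero
    rep∈bag u u∈S = dec-true (rep u ≟ rep v) (cong rep (S⊆v u u∈S))

    bag-assigned-or-internal : ∀ a s → a ∈V bag s → Assigned L a ⊎ Internal L S a
    bag-assigned-or-internal a s a∈bag =
      subst (λ x → Assigned L x ⊎ Internal L S x) (sym (from-does (a ≟ rep v) a∈bag))
            (map₁ (c v ,_) (rep-assigned-or-internal v v∈S))

    decomposition : Decomposition S E c L
    decomposition = record
      { size = 1 ; tree = point ; bag = bag ; rep = rep
      ; rep-assigned             = λ u _ _ e → cong (fromMaybe u) e
      ; rep-assigned-or-internal = rep-assigned-or-internal
      ; internal-dominated       = internal-dominated
      ; rep-in-bag               = λ u u∈S → zero , rep∈bag u u∈S
      ; edge-in-bag              = λ u w u∈S w∈S _ → zero , rep∈bag u u∈S , rep∈bag w w∈S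
      ; bag-walk                 = λ { _ zero zero a∈bag _ → here a∈bag }
      ; bag-coloured             = λ _ → (λ _ → just (rep v)) ,
                                   λ a a∈bag → c v , cong just (sym (from-does (a ≟ rep v) a∈bag))
      ; assigned-in-root         = λ { _ zero a∈bag _ → a∈bag }
      ; bag-assigned-or-internal = bag-assigned-or-internal
      }

  base-case : ∀ {S E c L} → Coherent L S c → (∀ u v → u ∈V S → v ∈V S → u ≡ v) → Decomposition S E c L
  base-case {S} coherent S-subsingleton with any? (λ v → S v Bool.≟ true)
  ... | yes (v , v∈S) = Singleton.decomposition coherent v v∈S (λ u u∈S → S-subsingleton u v u∈S v∈S)
  ... | no ¬S-inhabited = empty (λ v v∈S → ¬S-inhabited (v , v∈S))

  module Recolour {S : VSet N} {E : Rel N} {c c' : Fin N → Fin k} (i j : Fin k)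
                  (recoloured : ∀ v → v ∈V S → c v ≡ recol i j (c' v))
                  (L : Assignment) (coherent : Coherent L S c) where

    L' : Assignment
    L' = L ∘ recol i j

    L'∘c' : ∀ v → v ∈V S → L' (c' v) ≡ L (c v)
    L'∘c' v v∈S = cong L (sym (recoloured v v∈S))

    coherent' : Coherent L' S c'
    coherent' v v∈S (col , e) = trans (L'∘c' v v∈S) (coherent v v∈S (recol i j col , e))

    assigned⇐ : ∀ {a} → Assigned L' a → Assigned L a
    assigned⇐ (col , e) = recol i j col , e

    internal⇒ : ∀ {a} → Internal L S a → Internal L' S a
    internal⇒ (a∈S , ¬asg) = a∈S , ¬asg ∘ assigned⇐

    internal⇐ : ∀ {a} → Internal L' S a → Internal L S a
    internal⇐ {a} (a∈S , ¬asg') = a∈S , λ asg → ¬asg' (c' a , trans (L'∘c' a a∈S) (coherent a a∈S asg))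

    decomposition : Decomposition S E c' L' → Decomposition S E c L
    decomposition D = record
      { size = size ; tree = tree ; bag = bag ; rep = rep
      ; rep-assigned             = λ u a u∈S e → rep-assigned u a u∈S (trans (L'∘c' u u∈S) e)
      ; rep-assigned-or-internal = λ u u∈S → Sum.map (trans (sym (L'∘c' u u∈S))) internal⇐
                                                       (rep-assigned-or-internal u u∈S)
      ; internal-dominated       = λ u u∈S → internal-dominated u u∈S ∘ internal⇒
      ; rep-in-bag               = rep-in-bag
      ; edge-in-bag              = edge-in-bag
      ; bag-walk                 = bag-walk
      ; bag-coloured             = bag-coloured
      ; assigned-in-root         = assigned-in-root′
      ; bag-assigned-or-internal = λ a s → Sum.map assigned⇐ internal⇐ ∘ bag-assigned-or-internal a s
      }
      where
        open Decomposition D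
        assigned-in-root′ : ∀ a s → a ∈V bag s → Assigned L a → a ∈V bag (RootedTree.root tree)
        assigned-in-root′ a s a∈bag asg with bag-assigned-or-internal a s a∈bag
        ... | inj₁ asg' = assigned-in-root a s a∈bag asg'
        ... | inj₂ int' = ⊥-elim (proj₂ (internal⇐ int') asg)

  fill : Fin k → Fin N → Assignment → Assignment
  fill i r L col = if does (col ≟ i) then L col <∣> just r else L col

  module _ {i : Fin k} {r : Fin N} {L : Assignment} where

    fill-keeps : ∀ {col a} → L col ≡ just a → fill i r L col ≡ just a
    fill-keeps {col} e with does (col ≟ i)
    ... | true  rewrite e = refl
    ... | false = e

    fill-other : ∀ {col} → col ≢ i → fill i r L col ≡ L col
    fill-other {col} col≢i rewrite dec-false (col ≟ i) col≢i = refl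

    fill-fills : L i ≡ nothing → fill i r L i ≡ just r
    fill-fills e rewrite dec-true (i ≟ i) refl | e = refl

    fill-defined : ∃ λ a → fill i r L i ≡ just a
    fill-defined = by-cases (L i) refl
      where
        by-cases : ∀ x → L i ≡ x → ∃ λ a → fill i r L i ≡ just a
        by-cases (just a) e = a , fill-keeps e
        by-cases nothing  e = r , fill-fills e

    fill-cases : ∀ {col a} → fill i r L col ≡ just a → L col ≡ just a ⊎ (col ≡ i × a ≡ r × L i ≡ nothing)
    fill-cases {col} e with col ≟ i
    ... | no _     = inj₁ e
    ... | yes refl with L col
    ...   | just _  = inj₁ e
    ...   | nothing = inj₂ (refl , sym (just-injective e) , refl)

  module Join {S : VSet N} {E E' : Rel N} {c : Fin N → Fin k} (i j : Fin k) (i≢j : i ≢ j)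
              (rᵢ rⱼ : Fin N) (rᵢ∈S : rᵢ ∈V S) (rⱼ∈S : rⱼ ∈V S) (c-rᵢ : c rᵢ ≡ i) (c-rⱼ : c rⱼ ≡ j)
              (E'⊆E : ∀ u v → u ∈V S → v ∈V S → E' u v ≡ true → E u v ≡ true)
              (E⊆E'+join : ∀ u v → u ∈V S → v ∈V S → E u v ≡ true →
                 E' u v ≡ true ⊎ (c u ≡ i × c v ≡ j) ⊎ (c u ≡ j × c v ≡ i))
              (join⊆E : ∀ u v → u ∈V S → v ∈V S → (c u ≡ i × c v ≡ j) ⊎ (c u ≡ j × c v ≡ i) → E u v ≡ true)
              (L : Assignment) (coherent : Coherent L S c) where

    L' : Assignment
    L' = fill i rᵢ (fill j rⱼ L)

    L'-keeps : ∀ {col a} → L col ≡ just a → L' col ≡ just a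
    L'-keeps = fill-keeps {i} {rᵢ} {fill j rⱼ L} ∘ fill-keeps {j} {rⱼ} {L}

    L'-fills-i : L i ≡ nothing → L' i ≡ just rᵢ
    L'-fills-i e = fill-fills {i} {rᵢ} {fill j rⱼ L} (trans (fill-other {j} {rⱼ} {L} i≢j) e)

    L'-fills-j : L j ≡ nothing → L' j ≡ just rⱼ
    L'-fills-j = fill-keeps {i} {rᵢ} {fill j rⱼ L} ∘ fill-fills {j} {rⱼ} {L}

    L'-defined : ∀ col → col ≡ i ⊎ col ≡ j → ∃ λ a → L' col ≡ just a
    L'-defined _ (inj₁ refl) = fill-defined {i} {rᵢ} {fill j rⱼ L}
    L'-defined _ (inj₂ refl) = let a , e = fill-defined {j} {rⱼ} {L} in a , fill-keeps {i} {rᵢ} {fill j rⱼ L} e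

    L'-cases : ∀ {col a} → L' col ≡ just a →
               L col ≡ just a ⊎ (col ≡ i × a ≡ rᵢ × L i ≡ nothing) ⊎ (col ≡ j × a ≡ rⱼ × L j ≡ nothing)
    L'-cases {col} e with fill-cases {i = i} {rᵢ} {fill j rⱼ L} {col} e
    ... | inj₂ (refl , a≡rᵢ , e') = inj₂ (inj₁ (refl , a≡rᵢ , trans (sym (fill-other {j} {rⱼ} {L} i≢j)) e'))
    ... | inj₁ e' with fill-cases {i = j} {rⱼ} {L} {col} e'
    ...   | inj₁ e''                   = inj₁ e''
    ...   | inj₂ (refl , a≡rⱼ , e'')   = inj₂ (inj₂ (refl , a≡rⱼ , e''))

    fresh : ∀ {r} → r ∈V S → L (c r) ≡ nothing → Internal L S r
    fresh r∈S e = r∈S , λ asg → case trans (sym e) (coherent _ r∈S asg) of λ ()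

    coherent' : Coherent L' S c
    coherent' v v∈S (col , e) with L'-cases e
    ... | inj₁ e'                         = L'-keeps (coherent v v∈S (col , e'))
    ... | inj₂ (inj₁ (_ , refl , e'))   rewrite c-rᵢ = L'-fills-i e'
    ... | inj₂ (inj₂ (_ , refl , e'))   rewrite c-rⱼ = L'-fills-j e'

    internal⇐ : ∀ {a} → Internal L' S a → Internal L S a
    internal⇐ (a∈S , ¬asg') = a∈S , λ (col , e) → ¬asg' (col , L'-keeps e)

    L'-old-or-fresh : ∀ {col a} → L' col ≡ just a → L col ≡ just a ⊎ Internal L S a
    L'-old-or-fresh {col} e with L'-cases {col} e
    ... | inj₁ e'                        = inj₁ e'
    ... | inj₂ (inj₁ (_ , refl , e'))   = inj₂ (fresh rᵢ∈S (trans (cong L c-rᵢ) e'))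
    ... | inj₂ (inj₂ (_ , refl , e'))   = inj₂ (fresh rⱼ∈S (trans (cong L c-rⱼ) e'))

    assigned⇐ : ∀ {a} → Assigned L' a → Assigned L a ⊎ Internal L S a
    assigned⇐ (col , e) = map₁ (col ,_) (L'-old-or-fresh e)

    L'-new-injective : ∀ {a col col'} → ¬ Assigned L a → L' col ≡ just a → L' col' ≡ just a → col ≡ col'
    L'-new-injective {a} {col} {col'} ¬asg e e' with L'-cases {col} e | L'-cases {col'} e'
    ... | inj₁ e₀ | _      = ⊥-elim (¬asg (_ , e₀))
    ... | _      | inj₁ e₀ = ⊥-elim (¬asg (_ , e₀))
    ... | inj₂ (inj₁ (refl , _ , _)) | inj₂ (inj₁ (refl , _ , _)) = refl
    ... | inj₂ (inj₂ (refl , _ , _)) | inj₂ (inj₂ (refl , _ , _)) = refl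
    ... | inj₂ (inj₁ (refl , refl , _)) | inj₂ (inj₂ (refl , a≡rⱼ , _)) =
      ⊥-elim (i≢j (trans (sym c-rᵢ) (trans (cong c a≡rⱼ) c-rⱼ)))
    ... | inj₂ (inj₂ (refl , refl , _)) | inj₂ (inj₁ (refl , a≡rᵢ , _)) =
      ⊥-elim (i≢j (trans (sym c-rᵢ) (trans (cong c (sym a≡rᵢ)) c-rⱼ)))

    module _ (D : Decomposition S E' c L') where
      open Decomposition D

      -- The part newly represented by rᵢ consists of vertices of colour i, all joined to rⱼ;
      -- symmetrically for rⱼ.
      internal-dominated′ : ∀ u → u ∈V S → Internal L S (rep u) → DominatedPart S E rep (rep u)
      internal-dominated′ u u∈S (rep-u∈S , ¬asg) with assigned? L' (rep u)
      ... | no ¬asg' =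
        let (w , w∈S , dom) , idem = internal-dominated u u∈S (rep-u∈S , ¬asg')
        in (w , w∈S , λ v v∈S e → map₂ (E'⊆E w v w∈S v∈S) (dom v v∈S e)) , idem
      ... | yes asg'@(col , e) =
        dominator (L'-cases e) , rep-assigned (rep u) (rep u) rep-u∈S (coherent' (rep u) rep-u∈S asg')
        where
          colour : ∀ v → v ∈V S → rep v ≡ rep u → c v ≡ col
          colour v v∈S rep-v≡rep-u with rep-assigned-or-internal v v∈S
          ... | inj₁ e'           = L'-new-injective ¬asg (trans e' (cong just rep-v≡rep-u)) e
          ... | inj₂ (_ , ¬asg'') = ⊥-elim (¬asg'' (col , trans e (cong just (sym rep-v≡rep-u))))

          dominator : L col ≡ just (rep u) ⊎ (col ≡ i × rep u ≡ rᵢ × L i ≡ nothing)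
                                           ⊎ (col ≡ j × rep u ≡ rⱼ × L j ≡ nothing) →
                      ∃ λ w → w ∈V S × ∀ v → v ∈V S → rep v ≡ rep u → v ≡ w ⊎ E w v ≡ true
          dominator (inj₁ e') = ⊥-elim (¬asg (col , e'))
          dominator (inj₂ (inj₁ (col≡i , _))) =
            rⱼ , rⱼ∈S , λ v v∈S e' → inj₂ (join⊆E rⱼ v rⱼ∈S v∈S (inj₂ (c-rⱼ , trans (colour v v∈S e') col≡i)))
          dominator (inj₂ (inj₂ (col≡j , _))) =
            rᵢ , rᵢ∈S , λ v v∈S e' → inj₂ (join⊆E rᵢ v rᵢ∈S v∈S (inj₁ (c-rᵢ , trans (colour v v∈S e') col≡j)))

      rep-in-root : ∀ u → u ∈V S → c u ≡ i ⊎ c u ≡ j → rep u ∈V bag (RootedTree.root tree)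
      rep-in-root u u∈S c-u∈ij =
        let a , e   = L'-defined (c u) c-u∈ij
            s , u∈s = rep-in-bag u u∈S
        in assigned-in-root (rep u) s u∈s (c u , trans e (cong just (sym (rep-assigned u a u∈S e))))

      edge-in-bag′ : ∀ u v → u ∈V S → v ∈V S → E u v ≡ true → ∃ λ s → rep u ∈V bag s × rep v ∈V bag s
      edge-in-bag′ u v u∈S v∈S uv∈E with E⊆E'+join u v u∈S v∈S uv∈E
      ... | inj₁ uv∈E'            = edge-in-bag u v u∈S v∈S uv∈E'
      ... | inj₂ (inj₁ (cu , cv)) = _ , rep-in-root u u∈S (inj₁ cu) , rep-in-root v v∈S (inj₂ cv)
      ... | inj₂ (inj₂ (cu , cv)) = _ , rep-in-root u u∈S (inj₂ cu) , rep-in-root v v∈S (inj₁ cv)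

      decomposition : Decomposition S E c L
      decomposition = record
        { size = size ; tree = tree ; bag = bag ; rep = rep
        ; rep-assigned             = λ u a u∈S → rep-assigned u a u∈S ∘ L'-keeps
        ; rep-assigned-or-internal = λ u u∈S → [ L'-old-or-fresh , inj₂ ∘ internal⇐ ]′
                                                 (rep-assigned-or-internal u u∈S)
        ; internal-dominated       = internal-dominated′
        ; rep-in-bag               = rep-in-bag
        ; edge-in-bag              = edge-in-bag′
        ; bag-walk                 = bag-walk
        ; bag-coloured             = bag-coloured
        ; assigned-in-root         = λ { a s a∈bag (col , e) → assigned-in-root a s a∈bag (col , L'-keeps e) }
        ; bag-assigned-or-internal = λ a s → [ assigned⇐ , inj₂ ∘ internal⇐ ]′ ∘ bag-assigned-or-internal a s
        }

  module Union {S S₁ S₂ : VSet N} {E : Rel N} {c : Fin N → Fin k} {L : Assignment}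
               (S≡S₁∪S₂ : ∀ v → S v ≡ (S₁ v ∨ S₂ v))
               (disjoint : ∀ v → v ∈V S₁ → S₂ v ≡ false)
               (no-cross-edge : ∀ u v → u ∈V S₁ → v ∈V S₂ → E u v ≡ false)
               (E-sym : SymmetricOn S E) where

    S₁⊆S : ∀ v → v ∈V S₁ → v ∈V S
    S₁⊆S v v∈S₁ = trans (S≡S₁∪S₂ v) (cong (_∨ S₂ v) v∈S₁)

    S₂⊆S : ∀ v → v ∈V S₂ → v ∈V S
    S₂⊆S v v∈S₂ = trans (S≡S₁∪S₂ v) (trans (cong (S₁ v ∨_) v∈S₂) (∨-zeroʳ (S₁ v)))

    S₁∩S₂≡∅ : ∀ v → v ∈V S₁ → ¬ v ∈V S₂
    S₁∩S₂≡∅ v v∈S₁ v∈S₂ with () ← trans (sym v∈S₂) (disjoint v v∈S₁)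

    S₂⇒∉S₁ : ∀ v → v ∈V S₂ → S₁ v ≡ false
    S₂⇒∉S₁ v v∈S₂ with S₁ v in e
    ... | true  = ⊥-elim (S₁∩S₂≡∅ v e v∈S₂)
    ... | false = refl

    split : ∀ u → u ∈V S → u ∈V S₁ ⊎ u ∈V S₂
    split u u∈S with S₁ u in e
    ... | true  = inj₁ refl
    ... | false = inj₂ (trans (sym (trans (S≡S₁∪S₂ u) (cong (_∨ S₂ u) e))) u∈S)

    coherent₁ : Coherent L S c → Coherent L S₁ c
    coherent₁ coherent v = coherent v ∘ S₁⊆S v

    coherent₂ : Coherent L S c → Coherent L S₂ c
    coherent₂ coherent v = coherent v ∘ S₂⊆S v

    symmetric₁ : SymmetricOn S₁ E
    symmetric₁ u v u∈S₁ v∈S₁ = E-sym u v (S₁⊆S u u∈S₁) (S₁⊆S v v∈S₁)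

    symmetric₂ : SymmetricOn S₂ E
    symmetric₂ u v u∈S₂ v∈S₂ = E-sym u v (S₂⊆S u u∈S₂) (S₂⊆S v v∈S₂)

    not-internal-across : ∀ {Sₓ S_y} (D : Decomposition S_y E c L) → (∀ v → v ∈V S_y → ¬ v ∈V Sₓ) →
                          ∀ v → v ∈V S_y → ¬ Internal L Sₓ (Decomposition.rep D v)
    not-internal-across D disjoint′ v v∈S_y (rep-v∈Sₓ , ¬asg)
      with Decomposition.rep-assigned-or-internal D v v∈S_y
    ... | inj₁ e              = ¬asg (c v , e)
    ... | inj₂ (rep-v∈S_y , _) = disjoint′ _ rep-v∈S_y rep-v∈Sₓ

    module _ (D₁ : Decomposition S₁ E c L) (D₂ : Decomposition S₂ E c L) where
      private
        module D₁ = Decomposition D₁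
        module D₂ = Decomposition D₂
        module G  = Graft D₁.tree D₂.tree

      rep : Fin N → Fin N
      rep u = if S₁ u then D₁.rep u else D₂.rep u

      rep₁ : ∀ u → u ∈V S₁ → rep u ≡ D₁.rep u
      rep₁ u u∈S₁ rewrite u∈S₁ = refl

      rep₂ : ∀ u → u ∈V S₂ → rep u ≡ D₂.rep u
      rep₂ u u∈S₂ rewrite S₂⇒∉S₁ u u∈S₂ = refl

      bag : Fin G.t → VSet N
      bag = G.by-position (does ∘ assigned? L) D₁.bag D₂.bag

      Adj : Fin G.t → Fin G.t → Set
      Adj = RootedTree.Adj G.tree

      module Side {Sₓ : VSet N} (D : Decomposition Sₓ E c L) (Sₓ⊆S : ∀ v → v ∈V Sₓ → v ∈V S)
                  (rep≡ : ∀ u → u ∈V Sₓ → rep u ≡ Decomposition.rep D u)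
                  (part-in-side : ∀ v → v ∈V S → Internal L Sₓ (rep v) → v ∈V Sₓ)
                  (emb : Fin (Decomposition.size D) → Fin G.t)
                  (bag-emb : ∀ s → bag (emb s) ≡ Decomposition.bag D s)
                  (lift-Adj : ∀ {x y} → RootedTree.Adj (Decomposition.tree D) x y → Adj (emb x) (emb y))
                  (emb-root : G.parent (emb (RootedTree.root (Decomposition.tree D))) ≡ just zero) where
        private
          module D = Decomposition D

        to-bag : ∀ {a} s → a ∈V D.bag s → a ∈V bag (emb s)
        to-bag {a} s = trans (cong-app (bag-emb s) a)

        from-bag : ∀ {a} s → a ∈V bag (emb s) → a ∈V D.bag s
        from-bag {a} s = trans (sym (cong-app (bag-emb s) a))

        rep-to-bag : ∀ u s → u ∈V Sₓ → D.rep u ∈V D.bag s → rep u ∈V bag (emb s)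
        rep-to-bag u s u∈Sₓ = subst (λ x → x ∈V bag (emb s)) (sym (rep≡ u u∈Sₓ)) ∘ to-bag s

        rep-assigned : ∀ u a → u ∈V Sₓ → L (c u) ≡ just a → rep u ≡ a
        rep-assigned u a u∈Sₓ e = trans (rep≡ u u∈Sₓ) (D.rep-assigned u a u∈Sₓ e)

        rep-assigned-or-internal : ∀ u → u ∈V Sₓ → L (c u) ≡ just (rep u) ⊎ Internal L S (rep u)
        rep-assigned-or-internal u u∈Sₓ =
          subst (λ x → L (c u) ≡ just x ⊎ Internal L S x) (sym (rep≡ u u∈Sₓ))
                (map₂ (Product.map₁ (Sₓ⊆S _)) (D.rep-assigned-or-internal u u∈Sₓ))

        internal-dominated : ∀ u → u ∈V Sₓ → Internal L S (rep u) → DominatedPart S E rep (rep u)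
        internal-dominated u u∈Sₓ (_ , ¬asg)
          with D.rep-assigned-or-internal u u∈Sₓ | rep≡ u u∈Sₓ
        ... | inj₁ e  | rep-u≡ = ⊥-elim (¬asg (c u , trans e (cong just (sym rep-u≡))))
        ... | inj₂ int@(rep-u∈Sₓ , _) | rep-u≡ =
          let (w , w∈Sₓ , dom) , idem = D.internal-dominated u u∈Sₓ int
              dom′ : ∀ v → v ∈V S → rep v ≡ rep u → v ≡ w ⊎ E w v ≡ true
              dom′ v v∈S e =
                let v∈Sₓ = part-in-side v v∈S (subst (Internal L Sₓ) (sym (trans e rep-u≡)) int)
                in dom v v∈Sₓ (trans (sym (rep≡ v v∈Sₓ)) (trans e rep-u≡))
          in (w , Sₓ⊆S w w∈Sₓ , dom′) ,
             trans (cong rep rep-u≡) (trans (rep≡ _ rep-u∈Sₓ) (trans idem (sym rep-u≡)))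

        rep-in-bag : ∀ u → u ∈V Sₓ → ∃ λ s → rep u ∈V bag s
        rep-in-bag u u∈Sₓ = let s , u∈s = D.rep-in-bag u u∈Sₓ in emb s , rep-to-bag u s u∈Sₓ u∈s

        edge-in-bag : ∀ u v → u ∈V Sₓ → v ∈V Sₓ → E u v ≡ true → ∃ λ s → rep u ∈V bag s × rep v ∈V bag s
        edge-in-bag u v u∈Sₓ v∈Sₓ uv∈E =
          let s , u∈s , v∈s = D.edge-in-bag u v u∈Sₓ v∈Sₓ uv∈E
          in emb s , rep-to-bag u s u∈Sₓ u∈s , rep-to-bag v s v∈Sₓ v∈s

        bag-walk : ∀ a s s' → a ∈V bag (emb s) → a ∈V bag (emb s') →
                   Walk Adj (λ r → a ∈V bag r) (emb s) (emb s')
        bag-walk a s s' a∈s a∈s' =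
          Walk-map emb lift-Adj (to-bag _) (D.bag-walk a s s' (from-bag s a∈s) (from-bag s' a∈s'))

        walk-to-root : ∀ a s → a ∈V bag (emb s) → Assigned L a → Walk Adj (λ r → a ∈V bag r) (emb s) zero
        walk-to-root a s a∈s asg =
          let a∈root = D.assigned-in-root a s (from-bag s a∈s) asg
          in Walk-map emb lift-Adj (to-bag _) (D.bag-walk a s _ (from-bag s a∈s) a∈root)
             ++ʷ step (to-bag _ a∈root) (inj₁ emb-root) (here (dec-true (assigned? L a) asg))

        bag-coloured : ∀ s → ∃ λ (g : Fin k → Maybe (Fin N)) → ∀ a → a ∈V bag (emb s) → ∃ λ col → g col ≡ just a
        bag-coloured s = let g , covers = D.bag-coloured s in g , λ a → covers a ∘ from-bag s

        bag-assigned-or-internal : ∀ a s → a ∈V bag (emb s) → Assigned L a ⊎ Internal L Sₓ a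
        bag-assigned-or-internal a s = D.bag-assigned-or-internal a s ∘ from-bag s

      part-in-S₁ : ∀ v → v ∈V S → Internal L S₁ (rep v) → v ∈V S₁
      part-in-S₁ v v∈S int with split v v∈S
      ... | inj₁ v∈S₁ = v∈S₁
      ... | inj₂ v∈S₂ = ⊥-elim (not-internal-across D₂ (λ a a∈S₂ a∈S₁ → S₁∩S₂≡∅ a a∈S₁ a∈S₂) v v∈S₂
                                                    (subst (Internal L S₁) (rep₂ v v∈S₂) int))

      part-in-S₂ : ∀ v → v ∈V S → Internal L S₂ (rep v) → v ∈V S₂
      part-in-S₂ v v∈S int with split v v∈S
      ... | inj₂ v∈S₂ = v∈S₂
      ... | inj₁ v∈S₁ = ⊥-elim (not-internal-across D₁ S₁∩S₂≡∅ v v∈S₁ (subst (Internal L S₂) (rep₁ v v∈S₁) int))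

      module Side₁ = Side D₁ S₁⊆S rep₁ part-in-S₁ G.left
                       (G.by-position-left (does ∘ assigned? L) D₁.bag D₂.bag)
                       G.Left.lift-Adj G.Left.parent-emb-root
      module Side₂ = Side D₂ S₂⊆S rep₂ part-in-S₂ G.right
                       (G.by-position-right (does ∘ assigned? L) D₁.bag D₂.bag)
                       G.Right.lift-Adj G.Right.parent-emb-root

      walk-to-root : ∀ a s → a ∈V bag s → Assigned L a → Walk Adj (λ r → a ∈V bag r) s zero
      walk-to-root a s with position D₁.size D₂.size s
      ... | at-root    = λ a∈s _ → here a∈s
      ... | in-left x  = Side₁.walk-to-root a x
      ... | in-right y = Side₂.walk-to-root a y

      walk-via-root : ∀ a s s' → a ∈V bag s → a ∈V bag s' → Assigned L a → Walk Adj (λ r → a ∈V bag r) s s'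
      walk-via-root a s s' a∈s a∈s' asg =
        walk-to-root a s a∈s asg ++ʷ Walk-reverse {R = Adj} swap (walk-to-root a s' a∈s' asg)

      assigned-across : ∀ a x y → a ∈V bag (G.left x) → a ∈V bag (G.right y) → Assigned L a
      assigned-across a x y a∈x a∈y
        with Side₁.bag-assigned-or-internal a x a∈x | Side₂.bag-assigned-or-internal a y a∈y
      ... | inj₁ asg            | _                   = asg
      ... | inj₂ _              | inj₁ asg            = asg
      ... | inj₂ (a∈S₁ , _)     | inj₂ (a∈S₂ , _)     = ⊥-elim (S₁∩S₂≡∅ a a∈S₁ a∈S₂)

      bag-walk : ∀ a s s' → a ∈V bag s → a ∈V bag s' → Walk Adj (λ r → a ∈V bag r) s s'
      bag-walk a s s' a∈s a∈s' with position D₁.size D₂.size s | position D₁.size D₂.size s'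
      ... | in-left x  | in-left y  = Side₁.bag-walk a x y a∈s a∈s'
      ... | in-right x | in-right y = Side₂.bag-walk a x y a∈s a∈s'
      ... | at-root    | _          = walk-via-root a _ _ a∈s a∈s' (from-does (assigned? L a) a∈s)
      ... | in-left _  | at-root    = walk-via-root a _ _ a∈s a∈s' (from-does (assigned? L a) a∈s')
      ... | in-right _ | at-root    = walk-via-root a _ _ a∈s a∈s' (from-does (assigned? L a) a∈s')
      ... | in-left x  | in-right y = walk-via-root a _ _ a∈s a∈s' (assigned-across a x y a∈s a∈s')
      ... | in-right x | in-left y  = walk-via-root a _ _ a∈s a∈s' (assigned-across a y x a∈s' a∈s)

      edge-in-bag : ∀ u v → u ∈V S → v ∈V S → E u v ≡ true → ∃ λ s → rep u ∈V bag s × rep v ∈V bag s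
      edge-in-bag u v u∈S v∈S uv∈E with split u u∈S | split v v∈S
      ... | inj₁ u∈S₁ | inj₁ v∈S₁ = Side₁.edge-in-bag u v u∈S₁ v∈S₁ uv∈E
      ... | inj₂ u∈S₂ | inj₂ v∈S₂ = Side₂.edge-in-bag u v u∈S₂ v∈S₂ uv∈E
      ... | inj₁ u∈S₁ | inj₂ v∈S₂ with () ← trans (sym uv∈E) (no-cross-edge u v u∈S₁ v∈S₂)
      ... | inj₂ u∈S₂ | inj₁ v∈S₁
        with () ← trans (sym uv∈E) (trans (E-sym u v u∈S v∈S) (no-cross-edge v u v∈S₁ u∈S₂))

      bag-coloured : ∀ s → ∃ λ (g : Fin k → Maybe (Fin N)) → ∀ a → a ∈V bag s → ∃ λ col → g col ≡ just a
      bag-coloured s with position D₁.size D₂.size s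
      ... | at-root    = L , λ a → from-does (assigned? L a)
      ... | in-left x  = Side₁.bag-coloured x
      ... | in-right y = Side₂.bag-coloured y

      bag-assigned-or-internal : ∀ a s → a ∈V bag s → Assigned L a ⊎ Internal L S a
      bag-assigned-or-internal a s with position D₁.size D₂.size s
      ... | at-root    = inj₁ ∘ from-does (assigned? L a)
      ... | in-left x  = map₂ (Product.map₁ (S₁⊆S a)) ∘ Side₁.bag-assigned-or-internal a x
      ... | in-right y = map₂ (Product.map₁ (S₂⊆S a)) ∘ Side₂.bag-assigned-or-internal a y

      by-side : {P : Fin N → Set} → (∀ u → u ∈V S₁ → P u) → (∀ u → u ∈V S₂ → P u) → ∀ u → u ∈V S → P u
      by-side f₁ f₂ u u∈S = [ f₁ u , f₂ u ]′ (split u u∈S)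

      decomposition : Decomposition S E c L
      decomposition = record
        { size = G.t ; tree = G.tree ; bag = bag ; rep = rep
        ; rep-assigned             = λ u a → by-side (λ v → Side₁.rep-assigned v a)
                                                         (λ v → Side₂.rep-assigned v a) u
        ; rep-assigned-or-internal = by-side Side₁.rep-assigned-or-internal Side₂.rep-assigned-or-internal
        ; internal-dominated       = by-side Side₁.internal-dominated Side₂.internal-dominated
        ; rep-in-bag               = by-side Side₁.rep-in-bag Side₂.rep-in-bag
        ; edge-in-bag              = edge-in-bag
        ; bag-walk                 = bag-walk
        ; bag-coloured             = bag-coloured
        ; assigned-in-root         = λ a _ _ → dec-true (assigned? L a)
        ; bag-assigned-or-internal = bag-assigned-or-internal
        }

  -- In a join, the edge u₀v₀ missing from E' supplies a vertex of each of the colours i and j,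
  -- the representatives of the parts the join creates.
  decompose : ∀ {S E c} → CWPair k S E c → ∀ L → Coherent L S c → SymmetricOn S E → Decomposition S E c L
  decompose (base S-subsingleton) L coherent _ = base-case coherent S-subsingleton
  decompose (op1 S₁ S₂ S≡S₁∪S₂ disjoint _ _ no-cross-edge cw₁ cw₂) L coherent E-sym =
    U.decomposition (decompose cw₁ L (U.coherent₁ coherent) U.symmetric₁)
                    (decompose cw₂ L (U.coherent₂ coherent) U.symmetric₂)
    where module U = Union S≡S₁∪S₂ disjoint no-cross-edge E-sym
  decompose (op2 c' i j _ _ _ cw recoloured) L coherent E-sym =
    R.decomposition (decompose cw R.L' R.coherent' E-sym)
    where module R = Recolour {c' = c'} i j recoloured L coherent
  decompose (op3 E' i j i≢j E'-sym _ E'⊆E (u₀ , v₀ , u₀∈S , v₀∈S , u₀v₀∈E , u₀v₀∉E') E⊆E'+join join⊆E cw)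
            L coherent _ with E⊆E'+join u₀ v₀ u₀∈S v₀∈S u₀v₀∈E
  ... | inj₁ u₀v₀∈E' with () ← trans (sym u₀v₀∈E') u₀v₀∉E'
  ... | inj₂ (inj₁ (c-u₀ , c-v₀)) = J.decomposition (decompose cw J.L' J.coherent' E'-sym)
    where module J = Join i j i≢j u₀ v₀ u₀∈S v₀∈S c-u₀ c-v₀ E'⊆E E⊆E'+join
                          (λ u v u∈S v∈S → join⊆E u v u∈S v∈S ∘ inj₂) L coherent
  ... | inj₂ (inj₂ (c-u₀ , c-v₀)) = J.decomposition (decompose cw J.L' J.coherent' E'-sym)
    where module J = Join i j i≢j v₀ u₀ v₀∈S u₀∈S c-v₀ c-u₀ E'⊆E E⊆E'+join
                          (λ u v u∈S v∈S → join⊆E u v u∈S v∈S ∘ inj₂) L coherent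

module _ {k n : ℕ} (G : Graph n) {c : Fin n → Fin k} where
  open Construction k n

  -- With nothing assigned every part is internal, hence dominated and fixed by its representative.
  dominated-quotient : ∀ {w} → k ≤ suc w → Decomposition (λ _ → true) (adj G) c (λ _ → nothing) →
    Σ ℕ λ m → Σ (Fin n → Fin m) λ p → Surjective p × Dominated G p × TreewidthAtMost m (QuotAdj G p) w
  dominated-quotient {w} k≤1+w D =
    Parts.size , p , surjective , dominated ,
    _ , RootedTree.toTree tree , bag′ , covered , edge-covered , walk , bag′-size
    where
      open Decomposition D
      parts = enumerate (λ a → any? (λ v → rep v ≟ a))
      module Parts = Enumeration parts

      internal : ∀ u → Internal (λ _ → nothing) (λ _ → true) (rep u)
      internal u with rep-assigned-or-internal u refl
      ... | inj₂ int = int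

      p : Fin n → Fin Parts.size
      p v = proj₁ (Parts.complete (v , refl))

      element-p : ∀ v → Parts.element (p v) ≡ rep v
      element-p v = proj₂ (Parts.complete (v , refl))

      p-element : ∀ i → p (Parts.element i) ≡ i
      p-element i =
        let v , e = Parts.sound i
            rep-fixed = proj₂ (internal-dominated v refl (internal v))
        in Parts.injective (trans (element-p _) (subst (λ a → rep a ≡ a) e rep-fixed))

      surjective : Surjective p
      surjective i = let v , e = Parts.sound i in v , Parts.injective (trans (element-p v) e)

      dominated : Dominated G p
      dominated i with Parts.sound i
      ... | v , e with internal-dominated v refl (internal v)
      ...   | (w , _ , dom) , _ =
        w , λ u pu≡i → dom u refl (trans (sym (element-p u)) (trans (cong Parts.element pu≡i) (sym e)))

      bag′ : Fin size → Subset Parts.size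
      bag′ s = tabulate (λ i → bag s (Parts.element i))

      rep∈bag′ : ∀ u s → rep u ∈V bag s → p u ∈ bag′ s
      rep∈bag′ u s = ∈tabulate⁺ ∘ subst (_∈V bag s) (sym (element-p u))

      covered : ∀ i → ∃ λ s → i ∈ bag′ s
      covered i =
        let v , e    = Parts.sound i
            s , v∈s = rep-in-bag v refl
        in s , ∈tabulate⁺ (subst (_∈V bag s) e v∈s)

      edge-covered : ∀ i j → QuotAdj G p i j → ∃ λ s → i ∈ bag′ s × j ∈ bag′ s
      edge-covered _ _ (_ , u , v , refl , refl , uv∈E) =
        let s , u∈s , v∈s = edge-in-bag u v refl refl uv∈E in s , rep∈bag′ u s u∈s , rep∈bag′ v s v∈s

      walk : ∀ i s s' → i ∈ bag′ s → i ∈ bag′ s' → Walk (tadj (RootedTree.toTree tree)) (λ r → i ∈ bag′ r) s s'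
      walk i s s' i∈s i∈s' =
        Walk-map (λ r → r) (λ r → r) ∈tabulate⁺ (bag-walk _ s s' (∈tabulate⁻ i∈s) (∈tabulate⁻ i∈s'))

      bag′-size : ∀ s → ∣ bag′ s ∣ ≤ suc w
      bag′-size s =
        let g , covers = bag-coloured s
            covers′ : ∀ {i} → i ∈ bag′ s → ∃ λ col → Maybe.map p (g col) ≡ just i
            covers′ {i} i∈s = let col , e = covers _ (∈tabulate⁻ i∈s)
                              in col , trans (cong (Maybe.map p) e) (cong just (p-element i))
        in ≤-trans (⊆image⇒∣p∣≤k (bag′ s) (Maybe.map p ∘ g) covers′) k≤1+w

theorem3 : (k : ℕ) → 1 ≤ k → (n : ℕ) → (G : Graph n) → CliquewidthAtMost k G →
    Σ ℕ λ m → Σ (Fin n → Fin m) λ p →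
      Surjective p × Dominated G p × TreewidthAtMost m (QuotAdj G p) (k ∸ 1)
theorem3 k 1≤k n G (k' , k'≤k , c , cw) =
  dominated-quotient G (≤-trans k'≤k (≤-reflexive (sym (m+[n∸m]≡n 1≤k))))
    (decompose cw (λ _ → nothing) (λ _ _ ()) (λ u v _ _ → Graph.sym G u v))
  where open Construction k' n
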